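{- The path $P_4$ divides the hypercube $Q_5$.
   Context: $Q_5$ is the $5$-dimensional hypercube: vertex set the subsets of $\{1,\ldots,5\}$, with $x,y$ adjacent iff $|x\,\Delta\, y|=1$. $P_4$ is the path with $4$ edges. If $H$ is isomorphic to a subgraph of $G$, $H$ divides $G$ if there exist embeddings $\theta_1,\ldots,\theta_r$ of $H$ into $G$ such that $\{E(\theta_1(H)),\ldots,E(\theta_r(H))\}$ is a partition of $E(G)$. -}

module Defs where

open import Data.Bool using (Bool; not)
open import Data.Nat using (ℕ)
open import Data.Fin using (Fin; zero; suc; inject₁)
open import Data.Vec using (Vec; _[_]%=_)
open import Data.Product using (Σ; _×_; _,_)
open import Data.Sum using (_⊎_)
open import Function.Definitions using (Injective)
open import Relation.Binary.PropositionalEquality using (_≡_)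

-- Vertices of the hypercube Q_n: subsets of {1,…,n} as characteristic vectors.
QVertex : ℕ → Set
QVertex n = Vec Bool n

QAdj : {n : ℕ} → QVertex n → QVertex n → Set
QAdj {n} x y = Σ (Fin n) λ i → y ≡ (x [ i ]%= not)

-- The path P_k with k edges: vertices Fin (suc k), edges {inject₁ j , suc j} for j : Fin k.
-- An embedding of P_k into Q_n: an injective vertex map sending edges to edges.
record PathEmbedding (k n : ℕ) : Set where
  field
    vmap     : Fin (Data.Nat.suc k) → QVertex n
    injective : Injective _≡_ _≡_ vmap
    edges    : (j : Fin k) → QAdj (vmap (inject₁ j)) (vmap (suc j))
open PathEmbedding public

ImageEdge : {k n : ℕ} → PathEmbedding k n → Fin k → QVertex n → QVertex n → Set
ImageEdge θ j x y =
  (vmap θ (inject₁ j) ≡ x × vmap θ (suc j) ≡ y)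
  ⊎ (vmap θ (inject₁ j) ≡ y × vmap θ (suc j) ≡ x)

-- P_k divides Q_n: there are embeddings θ_1,…,θ_r whose edge sets partition E(Q_n),
-- i.e. every edge {x,y} of Q_n is the image of exactly one (embedding, path edge) pair.
PathDividesCube : ℕ → ℕ → Set
PathDividesCube k n =
  Σ ℕ λ r → Σ (Fin r → PathEmbedding k n) λ θ →
    (x y : QVertex n) → QAdj x y →
      Σ (Fin r × Fin k) λ { (a , j) → ImageEdge (θ a) j x y ×
        ((b : Fin r) (l : Fin k) → ImageEdge (θ b) l x y → (a , j) ≡ (b , l)) }

module Submission where

-- The decomposition consists of 20 paths, each described as a self-avoiding
-- walk in the cube: a start vertex and four coordinate directions to flip.
-- The walks form the orbits of two base walks under the group Z₅ × Z₂ of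
-- cube automorphisms generated by cyclic rotation of the coordinates and by
-- complementation; Q₅ has 80 edges and the two orbits supply 2 · 10 · 4 = 80
-- path edges, one for each edge of the cube.
--
-- The theorem follows by defining the two orbits and letting
-- the decision procedures confirm self-avoidance and the exact cover; the
-- symmetry only generates the walks, correctness is checked edge by edge.

open import Defs
open import Data.Bool using (Bool; true; false; not)
open import Data.Bool.Properties using () renaming (_≟_ to _≟ᵇ_)
open import Data.Nat using (ℕ; suc; _*_)
open import Data.Fin using (Fin; zero; suc; inject₁; fromℕ)
open import Data.Fin.Properties using (all?; any?) renaming (_≟_ to _≟ᶠ_)
open import Data.Fin.Subset.Properties using (anySubset?)
open import Data.Vec using (Vec; []; _∷_; _∷ʳ_; _[_]%=_; map; lookup; iterate; concat)
open import Data.Vec.Properties using (≡-dec)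
open import Data.Vec.Relation.Unary.All using (All) renaming (all? to all?ᵛ)
open import Data.Vec.Relation.Unary.All.Properties using (lookup⁺)
open import Data.Product using (Σ; _×_; _,_; proj₁; proj₂)
open import Data.Product.Properties using () renaming (≡-dec to ×-≡-dec)
open import Function.Definitions using (Injective)
open import Relation.Nullary using (Dec; yes; no; ¬?)
open import Relation.Nullary.Decidable using (toWitness; map′; decidable-stable; _×-dec_; _⊎-dec_; _→-dec_)
open import Relation.Binary.Definitions using (DecidableEquality)
open import Relation.Binary.PropositionalEquality using (_≡_; refl)

_≟ᵛ_ : {n : ℕ} → DecidableEquality (QVertex n)
_≟ᵛ_ = ≡-dec _≟ᵇ_

flip : {n : ℕ} → Fin n → QVertex n → QVertex n
flip i x = x [ i ]%= not

-- A property of all vertices of Q_n is decidable when it is decidable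
-- pointwise: vertices are subsets of {1,…,n}, and the library decides the
-- existence of a subset with a decidable property (here: a counterexample).
allVertices? : {n : ℕ} {P : QVertex n → Set} →
               ((x : QVertex n) → Dec (P x)) → Dec ((x : QVertex n) → P x)
allVertices? P? with anySubset? (λ x → ¬? (P? x))
... | yes (x , ¬Px) = no (λ ∀P → ¬Px (∀P x))
... | no ∄¬P        = yes (λ x → decidable-stable (P? x) (λ ¬Px → ∄¬P (x , ¬Px)))

injective? : {m : ℕ} {A : Set} → DecidableEquality A → (f : Fin m → A) →
             Dec (Injective _≡_ _≡_ f)
injective? _≟_ f =
  map′ (λ inj {a} {b} → inj a b) (λ inj a b → inj {a} {b})
       (all? (λ a → all? (λ b → (f a ≟ f b) →-dec (a ≟ᶠ b))))

record Walk (k n : ℕ) : Set where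
  constructor walk
  field
    start : QVertex n
    steps : Vec (Fin n) k
open Walk

vertexAfter : {k n : ℕ} → QVertex n → Vec (Fin n) k → Fin (suc k) → QVertex n
vertexAfter x ds       zero    = x
vertexAfter x (d ∷ ds) (suc j) = vertexAfter (flip d x) ds j

vertexAfter-adjacent : {k n : ℕ} (x : QVertex n) (ds : Vec (Fin n) k) (j : Fin k) →
                       QAdj (vertexAfter x ds (inject₁ j)) (vertexAfter x ds (suc j))
vertexAfter-adjacent x (d ∷ ds) zero    = d , refl
vertexAfter-adjacent x (d ∷ ds) (suc j) = vertexAfter-adjacent (flip d x) ds j

vertices : {k n : ℕ} → Walk k n → Fin (suc k) → QVertex n
vertices w = vertexAfter (start w) (steps w)

SelfAvoiding : {k n : ℕ} → Walk k n → Set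
SelfAvoiding w = Injective _≡_ _≡_ (vertices w)

selfAvoiding? : {k n : ℕ} (w : Walk k n) → Dec (SelfAvoiding w)
selfAvoiding? w = injective? _≟ᵛ_ (vertices w)

pathOfWalk : {k n : ℕ} (w : Walk k n) → SelfAvoiding w → PathEmbedding k n
pathOfWalk w sa = record
  { vmap      = vertices w
  ; injective = sa
  ; edges     = vertexAfter-adjacent (start w) (steps w)
  }

imageEdge? : {k n : ℕ} (θ : PathEmbedding k n) (j : Fin k) (x y : QVertex n) →
             Dec (ImageEdge θ j x y)
imageEdge? θ j x y =
  ((vmap θ (inject₁ j) ≟ᵛ x) ×-dec (vmap θ (suc j) ≟ᵛ y)) ⊎-dec
  ((vmap θ (inject₁ j) ≟ᵛ y) ×-dec (vmap θ (suc j) ≟ᵛ x))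

UniquelyCovered : {r k n : ℕ} → (Fin r → PathEmbedding k n) → QVertex n → QVertex n → Set
UniquelyCovered {r} {k} θ x y =
  Σ (Fin r × Fin k) λ p → ImageEdge (θ (proj₁ p)) (proj₂ p) x y ×
    ((b : Fin r) (l : Fin k) → ImageEdge (θ b) l x y → p ≡ (b , l))

uniquelyCovered? : {r k n : ℕ} (θ : Fin r → PathEmbedding k n) (x y : QVertex n) →
                   Dec (UniquelyCovered θ x y)
uniquelyCovered? θ x y =
  map′ (λ { (a , j , c) → (a , j) , c }) (λ { ((a , j) , c) → a , j , c })
    (any? λ a → any? λ j → imageEdge? (θ a) j x y ×-dec
      all? (λ b → all? λ l → imageEdge? (θ b) l x y →-dec ×-≡-dec _≟ᶠ_ _≟ᶠ_ (a , j) (b , l)))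

divides-of-exactCover : {r k n : ℕ} (θ : Fin r → PathEmbedding k n) →
                        ((x : QVertex n) (i : Fin n) → UniquelyCovered θ x (flip i x)) →
                        PathDividesCube k n
divides-of-exactCover {r} θ cover = r , θ , λ { x .(flip i x) (i , refl) →
  let ((a , j) , covered) = cover x i in (a , j) , covered }

exactCover? : {r k n : ℕ} (θ : Fin r → PathEmbedding k n) →
              Dec ((x : QVertex n) (i : Fin n) → UniquelyCovered θ x (flip i x))
exactCover? θ = allVertices? λ x → all? λ i → uniquelyCovered? θ x (flip i x)

-- The symmetries generating the decomposition act on walks.
-- Cyclic rotation of the coordinates, x ↦ (x₁,…,xₙ,x₀), moves coordinate i to i - 1.
rotateVertex : {n : ℕ} → QVertex (suc n) → QVertex (suc n)
rotateVertex (b ∷ x) = x ∷ʳ b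

cyclicPred : {n : ℕ} → Fin (suc n) → Fin (suc n)
cyclicPred {n} zero = fromℕ n
cyclicPred (suc i)  = inject₁ i

rotateWalk : {k n : ℕ} → Walk k (suc n) → Walk k (suc n)
rotateWalk w = walk (rotateVertex (start w)) (map cyclicPred (steps w))

-- Complementation x ↦ x̄ commutes with every flip, so the directions are kept.
complementWalk : {k n : ℕ} → Walk k n → Walk k n
complementWalk w = walk (map not (start w)) (steps w)

orbit : {k n : ℕ} → Walk k (suc n) → Vec (Walk k (suc n)) (suc n * 2)
orbit {n = n} w = concat (map (λ u → u ∷ complementWalk u ∷ []) (iterate rotateWalk w (suc n)))

-- The two base walks: 00000 → 10000 → 11000 → 01000 → 01010 and
-- 10000 → 10010 → 11010 → 11000 → 11100.
baseWalks : Vec (Walk 4 5) 2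
baseWalks =
  walk (false ∷ false ∷ false ∷ false ∷ false ∷ []) (zero ∷ suc zero ∷ zero ∷ suc (suc (suc zero)) ∷ []) ∷
  walk (true ∷ false ∷ false ∷ false ∷ false ∷ [])
       (suc (suc (suc zero)) ∷ suc zero ∷ suc (suc (suc zero)) ∷ suc (suc zero) ∷ []) ∷ []

decomposition : Vec (Walk 4 5) 20
decomposition = concat (map orbit baseWalks)

decomposition-selfAvoiding : All SelfAvoiding decomposition
decomposition-selfAvoiding = toWitness {a? = all?ᵛ selfAvoiding? decomposition} _

paths : Fin 20 → PathEmbedding 4 5
paths a = pathOfWalk (lookup decomposition a) (lookup⁺ decomposition-selfAvoiding a)

corollary7 : PathDividesCube 4 5
corollary7 = divides-of-exactCover paths (toWitness {a? = exactCover? paths} _)
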